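{- Let $\mathcal{A}$ be a dynamic-LOCAL algorithm that finds a nested orientation with constant locality $T$, and let $G$ be a graph with girth at least $2T+2$. Let $O$ be the orientation produced by $\mathcal{A}$ when run on $G$. Then $O$ does not induce a directed walk of length $T+1$ in $G$.
   Context: Graphs are simple, undirected, finite; $B(v,T)$ is the set of nodes within distance $T$ of $v$. Nested orientation: let $G=(V,E)$ with unique identifiers $f\colon V\to\{1,\dots,\mathrm{poly}(|V|)\}$ (part of the input). A nested orientation $(O,h)$ consists of an acyclic orientation $O$ of the edges and a labeling $h$ of the nodes with $h(v)=(f(v),F(v),H(v))$, where $F(v)=\{f(u):\{v,u\}\in E\}$ and $H(v)=\{h(u):(u,v)\in O\}$ is the set of labels of the in-neighbors of $v$ under $O$. Dynamic-LOCAL model with locality $T$: computation starts from the empty graph $G_0$; in step $i$ the adversary builds a supergraph $G_i$ of $G_{i-1}$ differing from it in exactly one node or one edge. Let $C_i$ be the set of nodes $v$ of $G_i$ with $G_i[B(v,T)]\ne G_{i-1}[B(v,T)]$. After each step the algorithm must output a feasible solution $L_i$ for $G_i$ with $L_i(v)=L_{i-1}(v)$ for all $v\notin C_i$ (the output of a node includes the orientation of its incident edges and its label $h$). "Run on $G$" means the adversary builds $G$ by such steps. -}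

module Defs where

open import Data.Nat using (ℕ; zero; suc; _+_; _*_; _≤_; _<_)
open import Data.Bool using (Bool; true; false; not)
open import Data.Fin using (Fin; inject₁; fromℕ) renaming (zero to fzero; suc to fsuc)
open import Data.List using (List; []; _∷_)
open import Data.List.Membership.Propositional using (_∈_)
open import Data.List.Relation.Unary.Any using (Any)
open import Data.Product using (Σ; ∃; _×_; _,_)
open import Data.Sum using (_⊎_)
open import Data.Unit using (⊤)
open import Data.Empty using (⊥)
open import Function.Bundles using (_⇔_)
open import Function.Definitions using (Injective)
open import Relation.Binary.PropositionalEquality using (_≡_)
open import Relation.Nullary using (¬_)

-- A node IS its unique identifier (a natural number), so the
-- identifier map f is the identity.  Simplicity/finiteness are guaranteed
-- by the fact that every graph considered is built from the empty graph
-- by adversary steps (see Run).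

record Graph : Set where
  field
    V : ℕ → Bool
    E : ℕ → ℕ → Bool
open Graph public

emptyGraph : Graph
emptyGraph = record { V = λ _ → false ; E = λ _ _ → false }

AddNode : Graph → Graph → Set
AddNode G G' = Σ ℕ λ x →
    V G x ≡ false × V G' x ≡ true
  × (∀ y → ¬ (y ≡ x) → V G' y ≡ V G y)
  × (∀ u w → E G' u w ≡ E G u w)

AddEdge : Graph → Graph → Set
AddEdge G G' = Σ ℕ λ a → Σ ℕ λ b →
    V G a ≡ true × V G b ≡ true × ¬ (a ≡ b) × E G a b ≡ false
  × (∀ y → V G' y ≡ V G y)
  × E G' a b ≡ true × E G' b a ≡ true
  × (∀ u w → ¬ ((u ≡ a × w ≡ b) ⊎ (u ≡ b × w ≡ a)) → E G' u w ≡ E G u w)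

Step : Graph → Graph → Set
Step G G' = AddNode G G' ⊎ AddEdge G G'

data Run : Graph → Set where
  start : Run emptyGraph
  step  : ∀ {G G'} → Run G → Step G G' → Run G'

data Walk (G : Graph) : ℕ → ℕ → ℕ → Set where
  here : ∀ {u} → V G u ≡ true → Walk G u u zero
  edge : ∀ {u x w k} → E G u x ≡ true → Walk G x w k → Walk G u w (suc k)

InBall : Graph → ℕ → ℕ → ℕ → Set
InBall G v T u = Σ ℕ λ k → k ≤ T × Walk G v u k

SameBall : Graph → Graph → ℕ → ℕ → Set
SameBall G G' T v =
    (∀ u → InBall G v T u ⇔ InBall G' v T u)
  × (∀ u w → InBall G' v T u → InBall G' v T w → E G u w ≡ E G' u w)

Cycle : Graph → ℕ → Set
Cycle G zero = ⊥
Cycle G (suc m) = 2 ≤ m × Σ (Fin (suc m) → ℕ) λ c →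
    Injective _≡_ _≡_ c
  × (∀ (i : Fin m) → E G (c (inject₁ i)) (c (fsuc i)) ≡ true)
  × E G (c (fromℕ m)) (c fzero) ≡ true

GirthAtLeast : Graph → ℕ → Set
GirthAtLeast G g = ∀ k → k < g → ¬ Cycle G k

-- Nested labels h(v) = (f(v), F(v), H(v)); sets represented by lists,
-- compared as sets (recursively, up to _≈_).

data Label : Set where
  node : ℕ → List ℕ → List Label → Label

mutual
  _≈_ : Label → Label → Set
  node i xs hs ≈ node j ys ks =
    i ≡ j × (∀ x → x ∈ xs ⇔ x ∈ ys) × hs ⊆≈ ks × ks ⊆≈ hs

  _⊆≈_ : List Label → List Label → Set
  [] ⊆≈ ks = ⊤
  (h ∷ hs) ⊆≈ ks = h ∈≈ ks × hs ⊆≈ ks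

  _∈≈_ : Label → List Label → Set
  h ∈≈ [] = ⊥
  h ∈≈ (k ∷ ks) = h ≈ k ⊎ h ∈≈ ks

-- Outputs.  The output of a node v: for every (incident) edge {v,u},
-- out u = true iff the edge is oriented v → u; and its label h(v).

record Out : Set where
  field
    out   : ℕ → Bool
    label : Label
open Out public

Output : Set
Output = ℕ → Out

Arc : Graph → Output → ℕ → ℕ → Set
Arc G L u w = E G u w ≡ true × out (L u) w ≡ true

data DWalk (G : Graph) (L : Output) : ℕ → ℕ → ℕ → Set where
  here : ∀ {u} → DWalk G L u u zero
  arc  : ∀ {u x w k} → Arc G L u x → DWalk G L x w k → DWalk G L u w (suc k)

HasDirectedWalk : Graph → Output → ℕ → Set
HasDirectedWalk G L k = Σ ℕ λ u → Σ ℕ λ w → DWalk G L u w k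

NestedOrientation : Graph → Output → Set
NestedOrientation G L =
    (∀ u w → E G u w ≡ true → out (L u) w ≡ not (out (L w) u))
  × (∀ v k → ¬ DWalk G L v v (suc k))
  × (∀ v → V G v ≡ true →
       Σ (List ℕ) λ Fv → Σ (List Label) λ Hv →
         label (L v) ≡ node v Fv Hv
       × (∀ x → x ∈ Fv ⇔ E G v x ≡ true)
       × (∀ ℓ → ℓ ∈ Hv → Σ ℕ λ u → Arc G L u v × ℓ ≈ label (L u))
       × (∀ u → Arc G L u v → Σ Label λ ℓ → ℓ ∈ Hv × ℓ ≈ label (L u)))

SameOut : Graph → ℕ → Out → Out → Set
SameOut G v o o' = (∀ u → E G v u ≡ true → out o u ≡ out o' u) × label o ≡ label o'

-- A dynamic-LOCAL algorithm with locality T finding nested orientations.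
-- The output after each step may depend on the whole history.

record DynLocalNestedOrientation (T : ℕ) : Set where
  field
    alg      : ∀ {G} → Run G → Output
    feasible : ∀ {G} (r : Run G) → NestedOrientation G (alg r)
    local    : ∀ {G G'} (r : Run G) (s : Step G G') (v : ℕ) →
               V G' v ≡ true → SameBall G G' T v →
               SameOut G v (alg r v) (alg (step r s) v)
open DynLocalNestedOrientation public

-- Let u = v₀ → v₁ → ⋯ → v_{T+1} = z be a directed walk. Acyclicity makes it a path, and along
-- each arc the tail's label is recorded in the head's label, so (a copy of) h(u) is nested in h(z).
-- As the girth is at least 2T + 2, any other walk from z back to u closes a short cycle unless it
-- retraces the path, so u lies outside the T-ball of z. The adversary may therefore add a fresh
-- node x and the edge {u, x} without changing that ball, and z keeps its label. In a nested
-- orientation every label nested in h(z) is the label of an actual node; its identifier makes that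
-- node u, whose neighbourhood now contains x, whereas the copy inside h(z) records the
-- neighbourhood of u from before x existed.

module Submission where

open import Defs
open import Data.Nat using (ℕ; zero; suc; _+_; _*_; _∸_; _≤_; _<_; z≤n; s≤s; s≤s⁻¹)
open import Data.Nat.Properties
open import Data.Bool using (true; false; _∨_; if_then_else_)
open import Data.Bool.Properties using (∨-zeroʳ; ¬-not)
open import Data.Fin using (Fin; toℕ; inject₁; fromℕ) renaming (zero to fzero; suc to fsuc)
open import Data.Fin.Properties using (toℕ-injective; toℕ-inject₁; toℕ-fromℕ; toℕ≤pred[n])
open import Data.List using ([]; _∷_)
open import Data.List.Membership.Propositional using (_∈_)
open import Data.List.Relation.Unary.Any using (here; there)
open import Data.Product using (Σ; ∃; _×_; _,_; proj₁; proj₂) renaming (map to map×)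
open import Data.Sum using (_⊎_; inj₁; inj₂; swap) renaming (map to map⊎)
open import Data.Unit using (tt)
open import Data.Empty using (⊥-elim)
open import Function using (_∘_; id)
open import Function.Bundles using (_⇔_; mk⇔; Equivalence)
import Function.Properties.Equivalence as ⇔
open import Relation.Binary.Definitions using (tri<; tri≈; tri>)
open import Relation.Binary.PropositionalEquality
open import Relation.Nullary using (¬_; Dec; yes; no; does; contradiction)
open import Relation.Nullary.Decidable using (dec-true; dec-false; _×-dec_; _⊎-dec_)

∈⇒∈≈ : ∀ {h k ks} → h ≈ k → k ∈ ks → h ∈≈ ks
∈⇒∈≈ h≈k (here refl) = inj₁ h≈k
∈⇒∈≈ h≈k (there k∈ks) = inj₂ (∈⇒∈≈ h≈k k∈ks)

mutual
  ≈-refl : ∀ {l} → l ≈ l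
  ≈-refl {node i xs hs} = refl , (λ _ → ⇔.refl) , ⊆⇒⊆≈ id , ⊆⇒⊆≈ id

  ⊆⇒⊆≈ : ∀ {hs ks} → (∀ {h} → h ∈ hs → h ∈ ks) → hs ⊆≈ ks
  ⊆⇒⊆≈ {[]} _ = tt
  ⊆⇒⊆≈ {h ∷ hs} sub = ∈⇒∈≈ ≈-refl (sub (here refl)) , ⊆⇒⊆≈ (sub ∘ there)

≈-sym : ∀ {l m} → l ≈ m → m ≈ l
≈-sym {node _ _ _} {node _ _ _} (i≡j , xs⇔ys , hs⊆ks , ks⊆hs) =
  sym i≡j , (λ x → ⇔.sym (xs⇔ys x)) , ks⊆hs , hs⊆ks

mutual
  ≈-trans : ∀ {l m n} → l ≈ m → m ≈ n → l ≈ n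
  ≈-trans {node _ _ _} {node _ _ _} {node _ _ _}
          (i≡j , xs⇔ys , hs⊆ks , ks⊆hs) (j≡k , ys⇔zs , ks⊆ms , ms⊆ks) =
    trans i≡j j≡k , (λ x → ⇔.trans (xs⇔ys x) (ys⇔zs x)) ,
    ⊆≈-trans hs⊆ks ks⊆ms , ⊆≈-trans ms⊆ks ks⊆hs

  ⊆≈-trans : ∀ {hs ks ms} → hs ⊆≈ ks → ks ⊆≈ ms → hs ⊆≈ ms
  ⊆≈-trans {[]} _ _ = tt
  ⊆≈-trans {h ∷ hs} (h∈ks , hs⊆ks) ks⊆ms = ∈≈-⊆≈ h∈ks ks⊆ms , ⊆≈-trans hs⊆ks ks⊆ms

  ∈≈-⊆≈ : ∀ {h ks ms} → h ∈≈ ks → ks ⊆≈ ms → h ∈≈ ms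
  ∈≈-⊆≈ {h} {k ∷ ks} (inj₁ h≈k) (k∈ms , _) = ∈≈-resp h≈k k∈ms
  ∈≈-⊆≈ {h} {k ∷ ks} (inj₂ h∈ks) (_ , ks⊆ms) = ∈≈-⊆≈ h∈ks ks⊆ms

  ∈≈-resp : ∀ {h k ms} → h ≈ k → k ∈≈ ms → h ∈≈ ms
  ∈≈-resp {h} {k} {m ∷ ms} h≈k (inj₁ k≈m) = inj₁ (≈-trans h≈k k≈m)
  ∈≈-resp {h} {k} {m ∷ ms} h≈k (inj₂ k∈ms) = inj₂ (∈≈-resp h≈k k∈ms)

⊆≈-witness : ∀ {h hs ks} → h ∈ hs → hs ⊆≈ ks → ∃ λ k → k ∈ ks × h ≈ k
⊆≈-witness (here refl) (h∈≈ks , _) = witness h∈≈ks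
  where
  witness : ∀ {h ks} → h ∈≈ ks → ∃ λ k → k ∈ ks × h ≈ k
  witness {ks = k ∷ _} (inj₁ h≈k) = k , here refl , h≈k
  witness {ks = _ ∷ _} (inj₂ h∈≈ks) = map× id (map× there id) (witness h∈≈ks)
⊆≈-witness (there h∈hs) (_ , hs⊆ks) = ⊆≈-witness h∈hs hs⊆ks

data _⊑_ (m : Label) : Label → Set where
  self   : ∀ {l} → m ≈ l → m ⊑ l
  inside : ∀ {i xs hs l} → l ∈ hs → m ⊑ l → m ⊑ node i xs hs

⊑-respʳ : ∀ {m l l'} → l ≈ l' → m ⊑ l → m ⊑ l'
⊑-respʳ l≈l' (self m≈l) = self (≈-trans m≈l l≈l')
⊑-respʳ {l' = node _ _ _} (_ , _ , hs⊆ks , _) (inside k∈hs m⊑k)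
  with ⊆≈-witness k∈hs hs⊆ks
... | k' , k'∈ks , k≈k' = inside k'∈ks (⊑-respʳ k≈k' m⊑k)

⊑-trans : ∀ {l m n} → l ⊑ m → m ⊑ n → l ⊑ n
⊑-trans l⊑m (self m≈n) = ⊑-respʳ m≈n l⊑m
⊑-trans l⊑m (inside k∈hs m⊑k) = inside k∈hs (⊑-trans l⊑m m⊑k)

EndpointsAreNodes : Graph → Set
EndpointsAreNodes G = ∀ {u w} → E G u w ≡ true → V G u ≡ true × V G w ≡ true

Joins : ℕ → ℕ → ℕ → ℕ → Set
Joins a b u w = (u ≡ a × w ≡ b) ⊎ (u ≡ b × w ≡ a)

joins? : ∀ a b u w → Dec (Joins a b u w)
joins? a b u w = (u ≟ a ×-dec w ≟ b) ⊎-dec (u ≟ b ×-dec w ≟ a)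

step-nodes : ∀ {G G' v} → Step G G' → V G v ≡ true → V G' v ≡ true
step-nodes {v = v} (inj₁ (x , _ , x∈G' , unchanged , _)) v∈G with v ≟ x
... | yes refl = x∈G'
... | no v≢x = trans (unchanged v v≢x) v∈G
step-nodes (inj₂ (_ , _ , _ , _ , _ , _ , sameV , _)) v∈G = trans (sameV _) v∈G

step-endpoints : ∀ {G G'} → Step G G' → EndpointsAreNodes G → EndpointsAreNodes G'
step-endpoints s@(inj₁ (_ , _ , _ , _ , sameE)) ends {u} {w} e =
  map× (step-nodes s) (step-nodes s) (ends (trans (sym (sameE u w)) e))
step-endpoints s@(inj₂ (a , b , a∈G , b∈G , _ , _ , _ , _ , _ , unchanged)) ends {u} {w} e
  with joins? a b u w
... | yes (inj₁ (refl , refl)) = step-nodes s a∈G , step-nodes s b∈G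
... | yes (inj₂ (refl , refl)) = step-nodes s b∈G , step-nodes s a∈G
... | no ¬joins = map× (step-nodes s) (step-nodes s) (ends (trans (sym (unchanged u w ¬joins)) e))

run⇒endpointsAreNodes : ∀ {G} → Run G → EndpointsAreNodes G
run⇒endpointsAreNodes start ()
run⇒endpointsAreNodes (step r s) = step-endpoints s (run⇒endpointsAreNodes r)

run⇒bounded : ∀ {G} → Run G → ∃ λ N → ∀ {v} → V G v ≡ true → v < N
run⇒bounded start = 0 , λ ()
run⇒bounded {G} (step r (inj₁ (x , _ , _ , unchanged , _))) with run⇒bounded r
... | N , bound = suc x + N , below
  where
  below : ∀ {v} → V G v ≡ true → v < suc x + N
  below {v} v∈G' with v ≟ x
  ... | yes refl = s≤s (m≤m+n x N)
  ... | no v≢x = <-≤-trans (bound (trans (sym (unchanged v v≢x)) v∈G')) (m≤n+m N (suc x))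
run⇒bounded (step r (inj₂ (_ , _ , _ , _ , _ , _ , sameV , _))) with run⇒bounded r
... | N , bound = N , λ v∈G' → bound (trans (sym (sameV _)) v∈G')

fresh : ∀ {G} → Run G → ∃ λ x → V G x ≡ false
fresh {G} r with run⇒bounded r
... | N , bound with V G N in N∈G
... | true = contradiction (bound N∈G) (n≮n N)
... | false = N , N∈G

nonNode-isolated : ∀ {G u x} → EndpointsAreNodes G → V G x ≡ false → ¬ E G u x ≡ true
nonNode-isolated ends x∉G e with () ← trans (sym (proj₂ (ends e))) x∉G

walk-end : ∀ {G u w k} → Walk G u w k → V G w ≡ true
walk-end (here w∈G) = w∈G
walk-end (edge _ p) = walk-end p

walk-mono : ∀ {G G' u w k} → (∀ {v} → V G v ≡ true → V G' v ≡ true) →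
            (∀ {v y} → E G v y ≡ true → E G' v y ≡ true) → Walk G u w k → Walk G' u w k
walk-mono V⊆ E⊆ (here w∈G) = here (V⊆ w∈G)
walk-mono V⊆ E⊆ (edge e p) = edge (E⊆ e) (walk-mono V⊆ E⊆ p)

InBall-map : ∀ {G G' v T u} → (∀ {k} → Walk G v u k → Walk G' v u k) → InBall G v T u → InBall G' v T u
InBall-map f (k , k≤T , p) = k , k≤T , f p

addNode : Graph → ℕ → Graph
addNode G x = record { V = λ v → does (v ≟ x) ∨ V G v ; E = E G }

addEdge : Graph → ℕ → ℕ → Graph
addEdge G a b = record { V = V G ; E = λ u w → does (joins? a b u w) ∨ E G u w }

module _ (G : Graph) (x : ℕ) where

  addNode-new : V (addNode G x) x ≡ true
  addNode-new = cong (_∨ V G x) (dec-true (x ≟ x) refl)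

  addNode-step : V G x ≡ false → AddNode G (addNode G x)
  addNode-step x∉G =
    x , x∉G , addNode-new ,
    (λ v v≢x → cong (_∨ V G v) (dec-false (v ≟ x) v≢x)) , (λ _ _ → refl)

  addNode-⊇ : ∀ {v} → V G v ≡ true → V (addNode G x) v ≡ true
  addNode-⊇ {v} v∈G = trans (cong (does (v ≟ x) ∨_) v∈G) (∨-zeroʳ _)

  addNode-walk⁻ : ∀ {v u k} → EndpointsAreNodes G → V G v ≡ true →
                  Walk (addNode G x) v u k → Walk G v u k
  addNode-walk⁻ ends v∈G (here _) = here v∈G
  addNode-walk⁻ ends v∈G (edge e p) = edge e (addNode-walk⁻ ends (proj₂ (ends e)) p)

  addNode-sameBall : ∀ {v T} → EndpointsAreNodes G → V G v ≡ true → SameBall G (addNode G x) T v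
  addNode-sameBall ends v∈G =
    (λ _ → mk⇔ (InBall-map (walk-mono addNode-⊇ id)) (InBall-map (addNode-walk⁻ ends v∈G))) ,
    (λ _ _ _ _ → refl)

module _ (G : Graph) (a b : ℕ) where

  addEdge-joins : ∀ {u w} → Joins a b u w → E (addEdge G a b) u w ≡ true
  addEdge-joins {u} {w} j = cong (_∨ E G u w) (dec-true (joins? a b u w) j)

  addEdge-⊇ : ∀ {u w} → E G u w ≡ true → E (addEdge G a b) u w ≡ true
  addEdge-⊇ {u} {w} e = trans (cong (does (joins? a b u w) ∨_) e) (∨-zeroʳ _)

  addEdge-unchanged : ∀ {u w} → ¬ Joins a b u w → E (addEdge G a b) u w ≡ E G u w
  addEdge-unchanged {u} {w} ¬j = cong (_∨ E G u w) (dec-false (joins? a b u w) ¬j)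

  addEdge-step : V G a ≡ true → V G b ≡ true → ¬ a ≡ b → E G a b ≡ false → AddEdge G (addEdge G a b)
  addEdge-step a∈G b∈G a≢b ¬ab =
    a , b , a∈G , b∈G , a≢b , ¬ab , (λ _ → refl) ,
    addEdge-joins (inj₁ (refl , refl)) , addEdge-joins (inj₂ (refl , refl)) ,
    λ _ _ → addEdge-unchanged

  addEdge-walk⁻ : ∀ {v u k} → V G a ≡ true → V G b ≡ true → Walk (addEdge G a b) v u k →
                  Walk G v u k ⊎ ∃ λ j → j < k × (Walk G v a j ⊎ Walk G v b j)
  addEdge-walk⁻ a∈G b∈G (here u∈G) = inj₁ (here u∈G)
  addEdge-walk⁻ {v} a∈G b∈G (edge {x = y} e p) with joins? a b v y
  ... | yes (inj₁ (refl , _)) = inj₂ (0 , s≤s z≤n , inj₁ (here a∈G))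
  ... | yes (inj₂ (refl , _)) = inj₂ (0 , s≤s z≤n , inj₂ (here b∈G))
  ... | no ¬joins =
    let e′ = trans (sym (addEdge-unchanged ¬joins)) e
    in map⊎ (edge e′) (λ (j , j<k , q) → suc j , s≤s j<k , map⊎ (edge e′) (edge e′) q)
            (addEdge-walk⁻ a∈G b∈G p)

  addEdge-sameBall : ∀ {v T} → V G a ≡ true → V G b ≡ true →
                     ¬ InBall G v T a → ¬ InBall G v T b → SameBall G (addEdge G a b) T v
  addEdge-sameBall {v} {T} a∈G b∈G a∉ball b∉ball =
    (λ _ → mk⇔ (InBall-map (walk-mono id addEdge-⊇)) ball⁻) ,
    λ u w u∈ball _ → sym (addEdge-unchanged (λ where
      (inj₁ (refl , _)) → a∉ball (ball⁻ u∈ball)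
      (inj₂ (refl , _)) → b∉ball (ball⁻ u∈ball)))
    where
    ball⁻ : ∀ {u} → InBall (addEdge G a b) v T u → InBall G v T u
    ball⁻ (k , k≤T , p) with addEdge-walk⁻ a∈G b∈G p
    ... | inj₁ q = k , k≤T , q
    ... | inj₂ (j , j<k , inj₁ q) = contradiction (j , ≤-trans (<⇒≤ j<k) k≤T , q) a∉ball
    ... | inj₂ (j , j<k , inj₂ q) = contradiction (j , ≤-trans (<⇒≤ j<k) k≤T , q) b∉ball

record IsPath (G : Graph) (q : ℕ → ℕ) (ℓ : ℕ) : Set where
  field
    adjacent  : ∀ {a} → a < ℓ → E G (q a) (q (suc a)) ≡ true
    injective : ∀ {a b} → a ≤ ℓ → b ≤ ℓ → q a ≡ q b → a ≡ b

IsPath-≤ : ∀ {G q i ℓ} → i ≤ ℓ → IsPath G q ℓ → IsPath G q i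
IsPath-≤ i≤ℓ path = record
  { adjacent  = λ a<i → IsPath.adjacent path (≤-trans a<i i≤ℓ)
  ; injective = λ a≤i b≤i → IsPath.injective path (≤-trans a≤i i≤ℓ) (≤-trans b≤i i≤ℓ)
  }

extend : (ℕ → ℕ) → ℕ → ℕ → ℕ → ℕ
extend q ℓ w a = if does (a ≤? ℓ) then q a else w

≤-suc-cases : ∀ {a ℓ} → a ≤ suc ℓ → a ≤ ℓ ⊎ a ≡ suc ℓ
≤-suc-cases a≤ = map⊎ s≤s⁻¹ id (m≤n⇒m<n∨m≡n a≤)

module _ (q : ℕ → ℕ) (ℓ w : ℕ) where

  extend-≤ : ∀ {a} → a ≤ ℓ → extend q ℓ w a ≡ q a
  extend-≤ {a} a≤ℓ = cong (if_then q a else w) (dec-true (a ≤? ℓ) a≤ℓ)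

  extend-suc : extend q ℓ w (suc ℓ) ≡ w
  extend-suc = cong (if_then q (suc ℓ) else w) (dec-false (suc ℓ ≤? ℓ) (n≮n ℓ))

  IsPath-extend : ∀ {G} → IsPath G q ℓ → E G (q ℓ) w ≡ true → (∀ {i} → i ≤ ℓ → ¬ q i ≡ w) →
                  IsPath G (extend q ℓ w) (suc ℓ)
  IsPath-extend {G} path e new = record { adjacent = adjacent ; injective = injective }
    where
    adjacent : ∀ {a} → a < suc ℓ → E G (extend q ℓ w a) (extend q ℓ w (suc a)) ≡ true
    adjacent a<1+ℓ with m≤n⇒m<n∨m≡n (s≤s⁻¹ a<1+ℓ)
    ... | inj₁ a<ℓ = subst₂ (λ s t → E G s t ≡ true) (sym (extend-≤ (<⇒≤ a<ℓ))) (sym (extend-≤ a<ℓ))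
                       (IsPath.adjacent path a<ℓ)
    ... | inj₂ refl = subst₂ (λ s t → E G s t ≡ true) (sym (extend-≤ ≤-refl)) (sym extend-suc) e

    injective : ∀ {a b} → a ≤ suc ℓ → b ≤ suc ℓ → extend q ℓ w a ≡ extend q ℓ w b → a ≡ b
    injective a≤ b≤ eq with ≤-suc-cases a≤ | ≤-suc-cases b≤
    ... | inj₁ a≤ℓ | inj₁ b≤ℓ =
      IsPath.injective path a≤ℓ b≤ℓ (trans (sym (extend-≤ a≤ℓ)) (trans eq (extend-≤ b≤ℓ)))
    ... | inj₁ a≤ℓ | inj₂ refl = ⊥-elim (new a≤ℓ (trans (sym (extend-≤ a≤ℓ)) (trans eq extend-suc)))
    ... | inj₂ refl | inj₁ b≤ℓ = ⊥-elim (new b≤ℓ (trans (sym (extend-≤ b≤ℓ)) (trans (sym eq) extend-suc)))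
    ... | inj₂ refl | inj₂ refl = refl

-- The cycle q i, q (i + 1), …, q ℓ closed by the edge {q ℓ, q i}.
IsPath-cycle : ∀ {G q i ℓ} → IsPath G q ℓ → 2 + i ≤ ℓ → E G (q ℓ) (q i) ≡ true →
               Cycle G (suc (ℓ ∸ i))
IsPath-cycle {G} {q} {i} {ℓ} path 2+i≤ℓ closing =
  2≤m , c , c-injective , c-adjacent , c-closing
  where
  m : ℕ
  m = ℓ ∸ i
  i+m≡ℓ : i + m ≡ ℓ
  i+m≡ℓ = m+[n∸m]≡n (≤-trans (n≤1+n i) (<⇒≤ 2+i≤ℓ))
  i+m≡ℓ′ : i + toℕ (fromℕ m) ≡ ℓ
  i+m≡ℓ′ = trans (cong (i +_) (toℕ-fromℕ m)) i+m≡ℓ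
  2≤m : 2 ≤ m
  2≤m = subst (_≤ m) (m+n∸n≡m 2 i) (∸-monoˡ-≤ i 2+i≤ℓ)
  c : Fin (suc m) → ℕ
  c j = q (i + toℕ j)
  on-path : ∀ (j : Fin (suc m)) → i + toℕ j ≤ ℓ
  on-path j = subst (i + toℕ j ≤_) i+m≡ℓ (+-monoʳ-≤ i (toℕ≤pred[n] j))
  c-closing : E G (c (fromℕ m)) (c fzero) ≡ true
  c-closing = subst₂ (λ s t → E G (q s) (q t) ≡ true) (sym i+m≡ℓ′) (sym (+-identityʳ i)) closing
  c-injective : ∀ {j j'} → c j ≡ c j' → j ≡ j'
  c-injective {j} {j'} eq = toℕ-injective (+-cancelˡ-≡ i _ _ (IsPath.injective path (on-path j) (on-path j') eq))
  c-adjacent : ∀ (j : Fin m) → E G (c (inject₁ j)) (c (fsuc j)) ≡ true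
  c-adjacent j =
    subst₂ (λ s t → E G (q s) (q t) ≡ true) (cong (i +_) (sym (toℕ-inject₁ j))) (sym (+-suc i (toℕ j)))
                   (IsPath.adjacent path (subst (_≤ ℓ) (+-suc i (toℕ j)) (on-path (fsuc j))))

≤-cases : ∀ {i ℓ} → i ≤ ℓ → i ≡ ℓ ⊎ suc i ≡ ℓ ⊎ 2 + i ≤ ℓ
≤-cases i≤ℓ with m≤n⇒m<n∨m≡n i≤ℓ
... | inj₂ i≡ℓ = inj₁ i≡ℓ
... | inj₁ i<ℓ = inj₂ (swap (m≤n⇒m<n∨m≡n i<ℓ))

-- Each step of the walk either extends the path, steps back along it, stays put, or closes a
-- cycle that is shorter than the girth allows.
path≤returnWalk : ∀ {G g q ℓ t s d} → GirthAtLeast G g → IsPath G q ℓ → Walk G t s d →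
                  q ℓ ≡ t → q 0 ≡ s → ℓ + d < g → ℓ ≤ d
path≤returnWalk girth path (here _) qℓ≡t q0≡s _ =
  ≤-reflexive (IsPath.injective path ≤-refl z≤n (trans qℓ≡t (sym q0≡s)))
path≤returnWalk {G} {g} {q} {ℓ} {d = suc d} girth path (edge {x = w} e p) refl q0≡s ℓ+1+d<g
  with anyUpTo? (λ i → q i ≟ w) (suc ℓ)
... | no w∉path =
  m<n⇒m≤1+n (path≤returnWalk girth
                (IsPath-extend q ℓ w path e (λ i≤ℓ qi≡w → w∉path (_ , s≤s i≤ℓ , qi≡w)))
                p (extend-suc q ℓ w) (trans (extend-≤ q ℓ w z≤n) q0≡s) (subst (_< g) (+-suc ℓ d) ℓ+1+d<g))
... | yes (i , i<1+ℓ , qi≡w) with ≤-cases (s≤s⁻¹ i<1+ℓ)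
...   | inj₁ refl =
  m≤n⇒m≤1+n (path≤returnWalk girth path p qi≡w q0≡s (<-trans (+-monoʳ-< ℓ (n<1+n d)) ℓ+1+d<g))
...   | inj₂ (inj₁ refl) =
  s≤s (path≤returnWalk girth (IsPath-≤ (n≤1+n i) path) p qi≡w q0≡s
         (<-trans (+-mono-< (n<1+n i) (n<1+n d)) ℓ+1+d<g))
...   | inj₂ (inj₂ 2+i≤ℓ) =
  ⊥-elim (girth _ (≤-<-trans (s≤s (≤-trans (m∸n≤m ℓ i) (m≤m+n ℓ d)))
                               (subst (_< g) (+-suc ℓ d) ℓ+1+d<g))
                  (IsPath-cycle path 2+i≤ℓ (subst (λ v → E G (q ℓ) v ≡ true) (sym qi≡w) e)))

module _ {G : Graph} {L : Output} where

  vertex : ∀ {u w k} → DWalk G L u w k → ℕ → ℕ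
  vertex {u} here _ = u
  vertex {u} (arc _ _) zero = u
  vertex (arc _ p) (suc j) = vertex p j

  vertex-first : ∀ {u w k} (p : DWalk G L u w k) → vertex p 0 ≡ u
  vertex-first here = refl
  vertex-first (arc _ _) = refl

  vertex-last : ∀ {u w k} (p : DWalk G L u w k) → vertex p k ≡ w
  vertex-last here = refl
  vertex-last (arc _ p) = vertex-last p

  vertex-arc : ∀ {u w k j} (p : DWalk G L u w k) → j < k → Arc G L (vertex p j) (vertex p (suc j))
  vertex-arc {j = zero} (arc uv p) _ = subst (Arc G L _) (sym (vertex-first p)) uv
  vertex-arc {j = suc j} (arc _ p) (s≤s j<k) = vertex-arc p j<k

  take : ∀ {u w k m} (p : DWalk G L u w k) → m ≤ k → DWalk G L u (vertex p m) m
  take {m = zero} here _ = here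
  take {m = zero} (arc _ _) _ = here
  take {m = suc m} (arc uv p) (s≤s m≤k) = arc uv (take p m≤k)

  segment : ∀ {u w k} a {m} (p : DWalk G L u w k) → a + m ≤ k → DWalk G L (vertex p a) (vertex p (a + m)) m
  segment zero {m} p a+m≤k = subst (λ v → DWalk G L v (vertex p m) m) (sym (vertex-first p)) (take p a+m≤k)
  segment (suc a) (arc _ p) (s≤s a+m≤k) = segment a p a+m≤k

  dwalk-source : ∀ {u w k} → EndpointsAreNodes G → DWalk G L u w (suc k) → V G u ≡ true
  dwalk-source ends (arc (e , _) _) = proj₁ (ends e)

  dwalk-target : ∀ {u w k} → EndpointsAreNodes G → DWalk G L u w (suc k) → V G w ≡ true
  dwalk-target ends (arc (e , _) here) = proj₂ (ends e)
  dwalk-target ends (arc _ p@(arc _ _)) = dwalk-target ends p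

  Acyclic : Set
  Acyclic = ∀ v k → ¬ DWalk G L v v (suc k)

  acyclic⇒distinct : ∀ {u w k a b} → Acyclic → (p : DWalk G L u w k) → a < b → b ≤ k →
                     ¬ vertex p a ≡ vertex p b
  acyclic⇒distinct {k = k} {a} {b} acyclic p a<b b≤k pa≡pb with o , 1+a+o≡b ← m≤n⇒∃[o]m+o≡n a<b =
    acyclic _ o (subst (λ v → DWalk G L _ v (suc o)) (trans (cong (vertex p) a+1+o≡b) (sym pa≡pb))
                  (segment a p (subst (_≤ k) (sym a+1+o≡b) b≤k)))
    where
    a+1+o≡b : a + suc o ≡ b
    a+1+o≡b = trans (+-suc a o) 1+a+o≡b

  acyclic⇒isPath : ∀ {u w k} → Acyclic → (p : DWalk G L u w k) → IsPath G (vertex p) k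
  acyclic⇒isPath {k = k} acyclic p = record
    { adjacent  = λ j<k → proj₁ (vertex-arc p j<k)
    ; injective = injective
    }
    where
    injective : ∀ {a b} → a ≤ k → b ≤ k → vertex p a ≡ vertex p b → a ≡ b
    injective {a} {b} a≤k b≤k pa≡pb with <-cmp a b
    ... | tri< a<b _ _ = contradiction pa≡pb (acyclic⇒distinct acyclic p a<b b≤k)
    ... | tri≈ _ a≡b _ = a≡b
    ... | tri> _ _ b<a = contradiction (sym pa≡pb) (acyclic⇒distinct acyclic p b<a a≤k)

  dwalk≤returnWalk : ∀ {g u w ℓ d} → GirthAtLeast G g → Acyclic →
                     DWalk G L u w ℓ → Walk G w u d → ℓ + d < g → ℓ ≤ d
  dwalk≤returnWalk girth acyclic p back =
    path≤returnWalk girth (acyclic⇒isPath acyclic p) back (vertex-last p) (vertex-first p)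

module _ {G : Graph} {L : Output} (nested : NestedOrientation G L) (ends : EndpointsAreNodes G) where

  arc⇒⊑ : ∀ {u w} → Arc G L u w → label (L u) ⊑ label (L w)
  arc⇒⊑ {u} {w} uw with proj₂ (proj₂ nested) w (proj₂ (ends (proj₁ uw)))
  ... | _ , _ , lw≡ , _ , _ , inNeighbours with inNeighbours u uw
  ...   | l , l∈H , l≈lu = subst (label (L u) ⊑_) (sym lw≡) (inside l∈H (self (≈-sym l≈lu)))

  dwalk⇒⊑ : ∀ {u w k} → DWalk G L u w k → label (L u) ⊑ label (L w)
  dwalk⇒⊑ here = self ≈-refl
  dwalk⇒⊑ (arc uv p) = ⊑-trans (arc⇒⊑ uv) (dwalk⇒⊑ p)

  ⊑⇒≈label : ∀ {m l z} → V G z ≡ true → m ⊑ l → l ≈ label (L z) →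
             ∃ λ w → V G w ≡ true × m ≈ label (L w)
  ⊑⇒≈label z∈G (self m≈l) l≈lz = _ , z∈G , ≈-trans m≈l l≈lz
  ⊑⇒≈label {z = z} z∈G (inside k∈hs m⊑k) l≈lz with proj₂ (proj₂ nested) z z∈G
  ... | _ , _ , lz≡ , _ , fromInNeighbours , _
    with ⊆≈-witness k∈hs (proj₁ (proj₂ (proj₂ (subst (_ ≈_) lz≡ l≈lz))))
  ... | k' , k'∈H , k≈k' with fromInNeighbours k' k'∈H
  ... | u , uz , k'≈lu = ⊑⇒≈label (proj₁ (ends (proj₁ uz))) m⊑k (≈-trans k≈k' k'≈lu)

≈label⇒sameNeighbours : ∀ {G G' L L' u w} → NestedOrientation G L → NestedOrientation G' L' →
                        V G u ≡ true → V G' w ≡ true → label (L u) ≈ label (L' w) →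
                        u ≡ w × (∀ y → E G u y ≡ true ⇔ E G' w y ≡ true)
≈label⇒sameNeighbours nested nested' u∈G w∈G' lu≈lw
  with proj₂ (proj₂ nested) _ u∈G | proj₂ (proj₂ nested') _ w∈G'
... | _ , _ , lu≡ , Fu , _ | _ , _ , lw≡ , Fw , _ with subst₂ _≈_ lu≡ lw≡ lu≈lw
... | u≡w , Fu⇔Fw , _ = u≡w , λ y → ⇔.trans (⇔.sym (Fu y)) (⇔.trans (Fu⇔Fw y) (Fw y))

⊑label⇒neighbours⊆ : ∀ {G G' L L' u z} → NestedOrientation G L → NestedOrientation G' L' →
                     EndpointsAreNodes G' → V G u ≡ true → V G' z ≡ true →
                     label (L u) ⊑ label (L' z) → ∀ y → E G' u y ≡ true → E G u y ≡ true
⊑label⇒neighbours⊆ nested nested' ends' u∈G z∈G' lu⊑lz y uy∈G'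
  with w , w∈G' , lu≈lw ← ⊑⇒≈label nested' ends' z∈G' lu⊑lz ≈-refl
  with refl , neighbours ← ≈label⇒sameNeighbours nested nested' u∈G w∈G' lu≈lw =
  Equivalence.from (neighbours y) uy∈G'

-- Neither step changes the T-ball of z, so locality keeps the output of z.
pendantRun : ∀ {T} (A : DynLocalNestedOrientation T) {G x u z} (r : Run G) →
             V G x ≡ false → V G u ≡ true → V G z ≡ true → ¬ InBall G z T u →
             Σ (Run (addEdge (addNode G x) u x)) λ r′ → label (alg A r′ z) ≡ label (alg A r z)
pendantRun A {G} {x} {u} {z} r x∉G u∈G z∈G u-far = r₂ , sym (trans (proj₂ label₁) (proj₂ label₂))
  where
  ends : EndpointsAreNodes G
  ends = run⇒endpointsAreNodes r
  u∈G₁ : V (addNode G x) u ≡ true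
  u∈G₁ = addNode-⊇ G x u∈G
  z∈G₁ : V (addNode G x) z ≡ true
  z∈G₁ = addNode-⊇ G x z∈G
  walk⁻ : ∀ {w k} → Walk (addNode G x) z w k → Walk G z w k
  walk⁻ = addNode-walk⁻ G x ends z∈G

  s₁ : Step G (addNode G x)
  s₁ = inj₁ (addNode-step G x x∉G)
  s₂ : Step (addNode G x) (addEdge (addNode G x) u x)
  s₂ = inj₂ (addEdge-step (addNode G x) u x u∈G₁ (addNode-new G x)
               (λ { refl → contradiction (trans (sym u∈G) x∉G) λ () })
               (¬-not (nonNode-isolated {G} {u} ends x∉G)))
  r₂ : Run (addEdge (addNode G x) u x)
  r₂ = step (step r s₁) s₂

  label₁ : SameOut G z (alg A r z) (alg A (step r s₁) z)
  label₁ = local A r s₁ z z∈G₁ (addNode-sameBall G x ends z∈G)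
  label₂ : SameOut (addNode G x) z (alg A (step r s₁) z) (alg A r₂ z)
  label₂ = local A (step r s₁) s₂ z z∈G₁
             (addEdge-sameBall (addNode G x) u x u∈G₁ (addNode-new G x) (u-far ∘ InBall-map walk⁻)
                (λ (_ , _ , back) → contradiction (trans (sym (walk-end (walk⁻ back))) x∉G) λ ()))

lemmaB2 : (T : ℕ) (A : DynLocalNestedOrientation T) (G : Graph) (r : Run G) →
          GirthAtLeast G (2 * T + 2) →
          ¬ HasDirectedWalk G (alg A r) (suc T)
lemmaB2 T A G r girth (u , z , p) =
  nonNode-isolated {G} {u} ends x∉G
    (⊑label⇒neighbours⊆ (feasible A r) (feasible A r′) (run⇒endpointsAreNodes r′)
       u∈G (addNode-⊇ G x z∈G)
       (subst (label (alg A r u) ⊑_) (sym sameLabel) (dwalk⇒⊑ (feasible A r) ends p))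
       x (addEdge-joins (addNode G x) u x (inj₁ (refl , refl))))
  where
  ends : EndpointsAreNodes G
  ends = run⇒endpointsAreNodes r
  x : ℕ
  x = proj₁ (fresh r)
  x∉G : V G x ≡ false
  x∉G = proj₂ (fresh r)
  u∈G : V G u ≡ true
  u∈G = dwalk-source ends p
  z∈G : V G z ≡ true
  z∈G = dwalk-target ends p

  u-far : ¬ InBall G z T u
  u-far (d , d≤T , back) =
    n≮n T (≤-trans (dwalk≤returnWalk girth (proj₁ (proj₂ (feasible A r))) p back budget) d≤T)
    where
    budget : suc T + d < 2 * T + 2
    budget = ≤-<-trans (+-monoʳ-≤ (suc T) d≤T)
               (≤-reflexive (trans (cong (λ n → 2 + (T + n)) (sym (+-identityʳ T))) (+-comm 2 (2 * T))))

  r′ : Run (addEdge (addNode G x) u x)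
  r′ = proj₁ (pendantRun A r x∉G u∈G z∈G u-far)
  sameLabel : label (alg A r′ z) ≡ label (alg A r z)
  sameLabel = proj₂ (pendantRun A r x∉G u∈G z∈G u-far)
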